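{- Let $\mathcal{S}=(\mathcal{P},\Sigma,\to)$ be a labeled transition system with silent action $\tau$, $p\in\mathcal P$, $Q\subseteq\mathcal P$ and $e\in(\mathbb N\cup\{\infty\})^8$. If $\varphi\in\mathsf{Strat}([p,Q],e)$ (a strategy formula for position $[p,Q]$ of the weak spectroscopy energy game $\mathcal G_\vartriangle^{\mathcal S}$ with energy $e$), then $\varphi$ distinguishes $p$ from $Q$, i.e. $p\in[\![\varphi]\!]$ and $q\notin[\![\varphi]\!]$ for every $q\in Q$.
   Context: Transition system: $\mathcal{S}=(\mathcal{P},\Sigma,\to)$, $\tau\in\Sigma$ silent. $\twoheadrightarrow$ is the reflexive-transitive closure of $\xrightarrow{\tau}$; $p$ is stable if it has no $\tau$-step; $p\xrightarrow{(\alpha)}p'$ means $p\xrightarrow{\alpha}p'$ or ($\alpha=\tau$ and $p=p'$). Relations are lifted to sets: $P\xrightarrow{\alpha}P'$ iff $P'=\{p'\mid\exists p\in P.\ p\xrightarrow{\alpha}p'\}$; similarly for $\twoheadrightarrow$ and $\xrightarrow{(\alpha)}$. Logic $\mathsf{HML}_{\mathrm{srbb}}[\Sigma]$ (conjunctions over arbitrary possibly infinite or empty sets, $\mathsf{T}:=\bigwedge\varnothing$): $\varphi ::= \langle\varepsilon\rangle\chi \mid \bigwedge\{\psi,\dots\}$; $\chi ::= \langle a\rangle\varphi\ (a\ne\tau) \mid \bigwedge\{\psi,\dots\} \mid \bigwedge\{\neg\langle\tau\rangle\mathsf{T},\psi,\dots\} \mid \bigwedge\{(\alpha)\varphi,\psi,\dots\}\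 (\alpha\in\Sigma)$; $\psi ::= \neg\langle\varepsilon\rangle\chi \mid \langle\varepsilon\rangle\chi$. Semantics: $[\![\langle\varepsilon\rangle\chi]\!]=\{p\mid\exists p'\in[\![\chi]\!]_\varepsilon.\ p\twoheadrightarrow p'\}$; $[\![\bigwedge\Psi]\!]=[\![\bigwedge\Psi]\!]_\varepsilon=\bigcap_{\psi\in\Psi}[\![\psi]\!]_\wedge$; $[\![\langle a\rangle\varphi]\!]_\varepsilon=\{p\mid\exists p'\in[\![\varphi]\!].\ p\xrightarrow{a}p'\}$; $[\![\neg\langle\tau\rangle\mathsf{T}]\!]_\wedge=\{p\mid p\text{ stable}\}$; $[\![(\alpha)\varphi]\!]_\wedge=\{p\mid\exists p'\in[\![\varphi]\!].\ p\xrightarrow{(\alpha)}p'\}$; $[\![\neg\langle\varepsilon\rangle\chi]\!]_\wedge=\mathcal{P}\setminus[\![\langle\varepsilon\rangle\chi]\!]$; $[\![\langle\varepsilon\rangle\chi]\!]_\wedge=[\![\langle\varepsilon\rangle\chi]\!]$. Energies $(\mathbb{N}\cup\{\infty\})^8$, componentwise order; $\hat{\mathbf e}_i$ unit vectors. Energy updates $u=(u_1,\dots,u_8)$, $u_k\in\{ -1,0\}$ or $u_k=\min_D$ with $k\in D\subseteq\{1,\dots,8\}$; $\mathsf{upd}(e,u)_k=e_k+u_k$ resp. $\min_{d\in D}e_d$; undefined if a component becomes negative. Game $\mathcal{G}_\vartriangle^{\mathcal S}$: attacker positions $[p,Q]$, $[p,Q]^\varepsilon$, $[p,q]^\wedge$,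 $[p,Q]^\eta$; defender positions $(p,Q)$, $(p,Q)^s$, $(p,\alpha,p',Q,Q_\alpha)^\eta$. Moves: delay $[p,Q]\xrightarrow{\mathbf 0}[p,Q']^\varepsilon$ if $Q\twoheadrightarrow Q'$; procrastination $[p,Q]^\varepsilon\xrightarrow{\mathbf 0}[p',Q]^\varepsilon$ if $p\xrightarrow{\tau}p'$, $p\ne p'$; observation $[p,Q]^\varepsilon\xrightarrow{ -\hat{\mathbf e}_1}[p',Q']$ if $p\xrightarrow{a}p'$, $Q\xrightarrow{a}Q'$, $a\ne\tau$; finishing $[p,\varnothing]\xrightarrow{\mathbf 0}(p,\varnothing)$; immediate conjunction $[p,Q]\xrightarrow{ -\hat{\mathbf e}_5}(p,Q)$ if $Q\ne\varnothing$; late conjunction $[p,Q]^\varepsilon\xrightarrow{\mathbf 0}(p,Q)$; conjunction answer $(p,Q)\xrightarrow{ -\hat{\mathbf e}_3}[p,q]^\wedge$ if $q\in Q$; positive conjunct $[p,q]^\wedge\xrightarrow{(\min_{\{1,6\}},0,\dots,0)}[p,Q]^\varepsilon$ if $\{q\}\twoheadrightarrow Q$; negative conjunct $[p,q]^\wedge\xrightarrow{(\min_{\{1,7\}},0,0,0,0,0,0,-1)}[q,Q]^\varepsilon$ if $\{p\}\twoheadrightarrow Q$, $p\ne q$; stable conjunction $[p,Q]^\varepsilon\xrightarrow{\mathbf 0}(p,Q')^s$ if $Q'=\{q\in Q\mid q\text{ stable}\}$ and $p$ stable; stable answer $(p,Q)^s\xrightarrow{ -\hat{\mathbf e}_4}[p,q]^\wedge$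 if $q\in Q$; stable finishing $(p,\varnothing)^s\xrightarrow{ -\hat{\mathbf e}_4}(p,\varnothing)$; branching conjunction $[p,Q]^\varepsilon\xrightarrow{\mathbf 0}(p,\alpha,p',Q\setminus Q_\alpha,Q_\alpha)^\eta$ if $p\xrightarrow{(\alpha)}p'$, $Q_\alpha\subseteq Q$; branching answer $(p,\alpha,p',Q,Q_\alpha)^\eta\xrightarrow{(0,-1,-1,0,0,0,0,0)}[p,q]^\wedge$ if $q\in Q$; branching observation $(p,\alpha,p',Q,Q_\alpha)^\eta\xrightarrow{(\min_{\{1,6\}},-1,-1,0,0,0,0,0)}[p',Q']^\eta$ with $Q_\alpha\xrightarrow{(\alpha)}Q'$; branching accounting $[p,Q]^\eta\xrightarrow{ -\hat{\mathbf e}_1}[p,Q]$. $\mathsf{Win}_{\mathrm a}(g)$: least sets such that for attacker $g$, $e\in\mathsf{Win}_{\mathrm a}(g)$ if some move $g\xrightarrow{u}g'$ has $\mathsf{upd}(e,u)$ defined and in $\mathsf{Win}_{\mathrm a}(g')$; for defender $g$, if every move $g\xrightarrow{u}g'$ has $\mathsf{upd}(e,u)$ defined and in $\mathsf{Win}_{\mathrm a}(g')$. Strategy formulas $\mathsf{Strat}(g,e)$ are the least sets closed under the following rules (each rule: whenever the listed game move exists, $e'=\mathsf{upd}(e,u)$ is defined and $e'\in\mathsf{Win}_{\mathrm a}$ of the target, and the premise formula is in $\mathsf{Strat}$ of the target with $e'$): (delay) move $[p,Q]\xrightarrow{u}[p,Q']^\varepsilon$, $\chi\in\mathsf{Strat}([p,Q']^\varepsilon,e')$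 $\Rightarrow$ $\langle\varepsilon\rangle\chi\in\mathsf{Strat}([p,Q],e)$; (procr) move $[p,Q]^\varepsilon\xrightarrow{u}[p',Q]^\varepsilon$, $\chi\in\mathsf{Strat}([p',Q]^\varepsilon,e')$ $\Rightarrow$ $\chi\in\mathsf{Strat}([p,Q]^\varepsilon,e)$; (observation) move $[p,Q]^\varepsilon\xrightarrow{u}[p',Q']$ with $p\xrightarrow{a}p'$, $Q\xrightarrow{a}Q'$, $\varphi\in\mathsf{Strat}([p',Q'],e')$ $\Rightarrow$ $\langle a\rangle\varphi\in\mathsf{Strat}([p,Q]^\varepsilon,e)$; (immediate conj) move $[p,Q]\xrightarrow{u}(p,Q)$, $\varphi\in\mathsf{Strat}((p,Q),e')$ $\Rightarrow$ $\varphi\in\mathsf{Strat}([p,Q],e)$; (late conj) move $[p,Q]^\varepsilon\xrightarrow{u}(p,Q)$, $\chi\in\mathsf{Strat}((p,Q),e')$ $\Rightarrow$ $\chi\in\mathsf{Strat}([p,Q]^\varepsilon,e)$; (conj) for all $q\in Q$: move $(p,Q)\xrightarrow{u_q}[p,q]^\wedge$, $e_q=\mathsf{upd}(e,u_q)\in\mathsf{Win}_{\mathrm a}([p,q]^\wedge)$, $\psi_q\in\mathsf{Strat}([p,q]^\wedge,e_q)$ $\Rightarrow$ $\bigwedge\{\psi_q\mid q\in Q\}\in\mathsf{Strat}((p,Q),e)$; (pos) move $[p,q]^\wedge\xrightarrow{u}[p,Q']^\varepsilon$, $\chi\in\mathsf{Strat}([p,Q']^\varepsilon,e')$ $\Rightarrow$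 $\langle\varepsilon\rangle\chi\in\mathsf{Strat}([p,q]^\wedge,e)$; (neg) move $[p,q]^\wedge\xrightarrow{u}[q,P']^\varepsilon$, $\chi\in\mathsf{Strat}([q,P']^\varepsilon,e')$ $\Rightarrow$ $\neg\langle\varepsilon\rangle\chi\in\mathsf{Strat}([p,q]^\wedge,e)$; (stable) move $[p,Q]^\varepsilon\xrightarrow{u}(p,Q')^s$, $\chi\in\mathsf{Strat}((p,Q')^s,e')$ $\Rightarrow$ $\chi\in\mathsf{Strat}([p,Q]^\varepsilon,e)$; (stable conj) $Q\ne\varnothing$ and for all $q\in Q$: move $(p,Q)^s\xrightarrow{u_q}[p,q]^\wedge$, $e_q=\mathsf{upd}(e,u_q)\in\mathsf{Win}_{\mathrm a}([p,q]^\wedge)$, $\psi_q\in\mathsf{Strat}([p,q]^\wedge,e_q)$ $\Rightarrow$ $\bigwedge(\{\neg\langle\tau\rangle\mathsf{T}\}\cup\{\psi_q\mid q\in Q\})\in\mathsf{Strat}((p,Q)^s,e)$; (stable finish) move $(p,\varnothing)^s\xrightarrow{u}(p,\varnothing)$ with $\mathsf{upd}(e,u)\in\mathsf{Win}_{\mathrm a}((p,\varnothing))$ $\Rightarrow$ $\bigwedge\{\neg\langle\tau\rangle\mathsf{T}\}\in\mathsf{Strat}((p,\varnothing)^s,e)$; (branch) move $[p,Q]^\varepsilon\xrightarrow{u}(p,\alpha,p',Q',Q_\alpha)^\eta$, $\chi\in\mathsf{Strat}((p,\alpha,p',Q',Q_\alpha)^\eta,e')$ $\Rightarrow$ $\chi\in\mathsf{Strat}([p,Q]^\varepsilon,e)$;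 (branch conj) with $g=(p,\alpha,p',Q,Q_\alpha)^\eta$: moves $g\xrightarrow{u_\alpha}[p',Q']^\eta\xrightarrow{u'_\alpha}[p',Q']$, $e_\alpha=\mathsf{upd}(\mathsf{upd}(e,u_\alpha),u'_\alpha)\in\mathsf{Win}_{\mathrm a}([p',Q'])$, $\varphi_\alpha\in\mathsf{Strat}([p',Q'],e_\alpha)$, and for all $q\in Q$: move $g\xrightarrow{u_q}[p,q]^\wedge$, $e_q=\mathsf{upd}(e,u_q)\in\mathsf{Win}_{\mathrm a}([p,q]^\wedge)$, $\psi_q\in\mathsf{Strat}([p,q]^\wedge,e_q)$ $\Rightarrow$ $\bigwedge(\{(\alpha)\varphi_\alpha\}\cup\{\psi_q\mid q\in Q\})\in\mathsf{Strat}(g,e)$. -}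

module Defs where

open import Data.Nat using (ℕ; zero; suc)
open import Data.Fin using (Fin; zero; suc; #_) renaming (_≟_ to _≟F_)
open import Data.Vec using (Vec; []; _∷_; lookup; tabulate)
open import Data.List using (List; []; _∷_; foldr; map)
open import Data.List.Membership.Propositional using (_∈_)
open import Data.List.Relation.Unary.Any using (here)
open import Data.Maybe using (Maybe; just; nothing)
open import Data.Product using (Σ; ∃; _×_; _,_; proj₁)
open import Data.Sum using (_⊎_)
open import Data.Empty using (⊥; ⊥-elim)
open import Relation.Nullary using (¬_; yes; no)
open import Relation.Binary.PropositionalEquality using (_≡_; _≢_; refl)
open import Relation.Binary.Construct.Closure.ReflexiveTransitive using (Star)

record LTS : Set₁ where
  field
    Proc : Set
    Act  : Set
    τ    : Act
    _⟶[_]_ : Proc → Act → Proc → Set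

data ℕ∞ : Set where
  fin : ℕ → ℕ∞
  ∞   : ℕ∞

_⊓∞_ : ℕ∞ → ℕ∞ → ℕ∞
fin m ⊓∞ fin n = fin (Data.Nat._⊓_ m n)
fin m ⊓∞ ∞     = fin m
∞     ⊓∞ y     = y

pred∞ : ℕ∞ → Maybe ℕ∞
pred∞ (fin zero)    = nothing
pred∞ (fin (suc n)) = just (fin n)
pred∞ ∞             = just ∞

Energy : Set
Energy = Vec ℕ∞ 8

-- A component u_k of an update: 0, -1, or min_D with k ∈ D.
-- Components are indexed 0..7 (paper's index i is Fin index i-1).
data UComp (k : Fin 8) : Set where
  keep  : UComp k
  dec   : UComp k
  minOf : (D : List (Fin 8)) → k ∈ D → UComp k

Update : Set
Update = (k : Fin 8) → UComp k

applyC : Energy → (k : Fin 8) → UComp k → Maybe ℕ∞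
applyC e k keep        = just (lookup e k)
applyC e k dec         = pred∞ (lookup e k)
applyC e k (minOf D _) = just (foldr _⊓∞_ ∞ (map (lookup e) D))

sequenceV : ∀ {A : Set} {n} → Vec (Maybe A) n → Maybe (Vec A n)
sequenceV [] = just []
sequenceV (nothing ∷ xs) = nothing
sequenceV (just x ∷ xs) with sequenceV xs
... | nothing = nothing
... | just ys = just (x ∷ ys)

-- upd(e,u); nothing = undefined (some component negative)
upd : Energy → Update → Maybe Energy
upd e u = sequenceV (tabulate (λ k → applyC e k (u k)))

𝟎 : Update
𝟎 _ = keep

-- -ê_i  (with i given as Fin index, i.e. paper's ê_{i+1})
−ê : Fin 8 → Update
−ê i k with k ≟F i
... | yes _ = dec
... | no  _ = keep

-- (min_{1,6},0,0,0,0,0,0,0)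
u-min16 : Update
u-min16 zero    = minOf (# 0 ∷ # 5 ∷ []) (here refl)
u-min16 (suc _) = keep

-- (min_{1,7},0,0,0,0,0,0,-1)
u-min17 : Update
u-min17 zero = minOf (# 0 ∷ # 6 ∷ []) (here refl)
u-min17 (suc (suc (suc (suc (suc (suc (suc zero))))))) = dec
u-min17 _ = keep

-- (0,-1,-1,0,0,0,0,0)
u-branchAns : Update
u-branchAns (suc zero)       = dec
u-branchAns (suc (suc zero)) = dec
u-branchAns _ = keep

-- (min_{1,6},-1,-1,0,0,0,0,0)
u-branchObs : Update
u-branchObs zero = minOf (# 0 ∷ # 5 ∷ []) (here refl)
u-branchObs (suc zero)       = dec
u-branchObs (suc (suc zero)) = dec
u-branchObs _ = keep

module Game (S : LTS) where
  open LTS S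

  Pred : Set₁
  Pred = Proc → Set

  Empty : Pred → Set
  Empty Q = ∀ q → ¬ Q q

  _↠_ : Proc → Proc → Set
  _↠_ = Star (λ p p' → p ⟶[ τ ] p')

  Stable : Proc → Set
  Stable p = ∀ p' → ¬ (p ⟶[ τ ] p')

  _⟶⟨_⟩_ : Proc → Act → Proc → Set
  p ⟶⟨ α ⟩ p' = (p ⟶[ α ] p') ⊎ ((α ≡ τ) × (p ≡ p'))

  ↠set : Pred → Pred
  ↠set Q q' = ∃ λ q → Q q × q ↠ q'

  stepSet : Act → Pred → Pred
  stepSet a Q q' = ∃ λ q → Q q × q ⟶[ a ] q'

  stepSet⟨⟩ : Act → Pred → Pred
  stepSet⟨⟩ α Q q' = ∃ λ q → Q q × q ⟶⟨ α ⟩ q'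

  ｛_｝ : Proc → Pred
  ｛ p ｝ q = q ≡ p

  stablePart : Pred → Pred
  stablePart Q q = Q q × Stable q

  _∖_ : Pred → Pred → Pred
  (Q ∖ R) q = Q q × ¬ R q

  _⊆_ : Pred → Pred → Set
  R ⊆ Q = ∀ q → R q → Q q

  mutual
    data Φ : Set₁ where
      ⟨ε⟩_ : X → Φ
      ⋀Φ   : (I : Set) → (I → Ψ) → Φ

    data X : Set₁ where
      ⟨_⟩_∣_ : (a : Act) → Φ → a ≢ τ → X
      ⋀X     : (I : Set) → (I → Ψ) → X
      -- ⋀ ({¬⟨τ⟩T} ∪ {ψ_i | i ∈ I})
      ⋀stable : (I : Set) → (I → Ψ) → X
      -- ⋀ ({(α)φ} ∪ {ψ_i | i ∈ I})
      ⋀branch : (α : Act) → Φ → (I : Set) → (I → Ψ) → X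

    data Ψ : Set₁ where
      ¬⟨ε⟩_ : X → Ψ
      +⟨ε⟩_ : X → Ψ

  mutual
    ⟦_⟧ : Φ → Pred
    ⟦ ⟨ε⟩ χ ⟧ p  = ⟦ χ ⟧εdiamond p
    ⟦ ⋀Φ I ψ ⟧ p = ∀ i → ⟦ ψ i ⟧∧ p

    ⟦_⟧εdiamond : X → Pred
    ⟦ χ ⟧εdiamond p = ∃ λ p' → p ↠ p' × ⟦ χ ⟧ε p'

    ⟦_⟧ε : X → Pred
    ⟦ ⟨ a ⟩ φ ∣ _ ⟧ε p = ∃ λ p' → p ⟶[ a ] p' × ⟦ φ ⟧ p'
    ⟦ ⋀X I ψ ⟧ε p = ∀ i → ⟦ ψ i ⟧∧ p
    ⟦ ⋀stable I ψ ⟧ε p = Stable p × (∀ i → ⟦ ψ i ⟧∧ p)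
    ⟦ ⋀branch α φ I ψ ⟧ε p =
      (∃ λ p' → p ⟶⟨ α ⟩ p' × ⟦ φ ⟧ p') × (∀ i → ⟦ ψ i ⟧∧ p)

    ⟦_⟧∧ : Ψ → Pred
    ⟦ ¬⟨ε⟩ χ ⟧∧ p = ¬ ⟦ χ ⟧εdiamond p
    ⟦ +⟨ε⟩ χ ⟧∧ p = ⟦ χ ⟧εdiamond p

  data Pos : Set₁ where
    att     : Proc → Pred → Pos
    attε    : Proc → Pred → Pos
    attConj : Proc → Proc → Pos
    attη    : Proc → Pred → Pos
    def     : Proc → Pred → Pos
    defS    : Proc → Pred → Pos
    defη    : Proc → Act → Proc → Pred → Pred → Pos

  data Attacker : Pos → Set₁ where
    a-att  : ∀ {p Q} → Attacker (att p Q)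
    a-attε : ∀ {p Q} → Attacker (attε p Q)
    a-attC : ∀ {p q} → Attacker (attConj p q)
    a-attη : ∀ {p Q} → Attacker (attη p Q)

  data Defender : Pos → Set₁ where
    d-def  : ∀ {p Q} → Defender (def p Q)
    d-defS : ∀ {p Q} → Defender (defS p Q)
    d-defη : ∀ {p α p' Q Qα} → Defender (defη p α p' Q Qα)

  data Move : Pos → Update → Pos → Set₁ where
    delay : ∀ {p Q} → Move (att p Q) 𝟎 (attε p (↠set Q))
    procrastination : ∀ {p p' Q} → p ⟶[ τ ] p' → p ≢ p' →
      Move (attε p Q) 𝟎 (attε p' Q)
    observation : ∀ {p p' Q a} → p ⟶[ a ] p' → a ≢ τ →
      Move (attε p Q) (−ê (# 0)) (att p' (stepSet a Q))
    finishing : ∀ {p Q} → Empty Q → Move (att p Q) 𝟎 (def p Q)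
    immediateConj : ∀ {p Q} → ¬ Empty Q → Move (att p Q) (−ê (# 4)) (def p Q)
    lateConj : ∀ {p Q} → Move (attε p Q) 𝟎 (def p Q)
    conjAnswer : ∀ {p Q q} → Q q → Move (def p Q) (−ê (# 2)) (attConj p q)
    positiveConjunct : ∀ {p q} →
      Move (attConj p q) u-min16 (attε p (↠set ｛ q ｝))
    negativeConjunct : ∀ {p q} → p ≢ q →
      Move (attConj p q) u-min17 (attε q (↠set ｛ p ｝))
    stableConj : ∀ {p Q} → Stable p →
      Move (attε p Q) 𝟎 (defS p (stablePart Q))
    stableAnswer : ∀ {p Q q} → Q q → Move (defS p Q) (−ê (# 3)) (attConj p q)
    stableFinishing : ∀ {p Q} → Empty Q → Move (defS p Q) (−ê (# 3)) (def p Q)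
    branchingConj : ∀ {p α p' Q Qα} → p ⟶⟨ α ⟩ p' → Qα ⊆ Q →
      Move (attε p Q) 𝟎 (defη p α p' (Q ∖ Qα) Qα)
    branchingAnswer : ∀ {p α p' Q Qα q} → Q q →
      Move (defη p α p' Q Qα) u-branchAns (attConj p q)
    branchingObservation : ∀ {p α p' Q Qα} →
      Move (defη p α p' Q Qα) u-branchObs (attη p' (stepSet⟨⟩ α Qα))
    branchingAccounting : ∀ {p Q} → Move (attη p Q) (−ê (# 0)) (att p Q)

  data Win : Pos → Energy → Set₁ where
    winA : ∀ {g e u g' e'} → Attacker g → Move g u g' →
      upd e u ≡ just e' → Win g' e' → Win g e
    winD : ∀ {g e} → Defender g →
      (∀ {u g'} → Move g u g' → Σ Energy λ e' → upd e u ≡ just e' × Win g' e') →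
      Win g e

  -- kind of formula produced at each position; at (p,Q) we record the
  -- family of conjuncts {ψ_q | q ∈ Q}, which is read as a φ (immediate
  -- conjunction) or as a χ (late conjunction).
  FormAt : Pos → Set₁
  FormAt (att _ _)         = Φ
  FormAt (attε _ _)        = X
  FormAt (attConj _ _)     = Ψ
  FormAt (attη _ _)        = Φ
  FormAt (def _ Q)         = Σ Proc Q → Ψ
  FormAt (defS _ _)        = X
  FormAt (defη _ _ _ _ _)  = X

  data Strat : (g : Pos) → Energy → FormAt g → Set₁ where
    s-delay : ∀ {p Q Q' e u e' χ} → Move (att p Q) u (attε p Q') →
      upd e u ≡ just e' → Win (attε p Q') e' → Strat (attε p Q') e' χ →
      Strat (att p Q) e (⟨ε⟩ χ)
    s-procr : ∀ {p p' Q e u e' χ} → Move (attε p Q) u (attε p' Q) →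
      upd e u ≡ just e' → Win (attε p' Q) e' → Strat (attε p' Q) e' χ →
      Strat (attε p Q) e χ
    s-observation : ∀ {p p' Q Q' a e u e' φ} (a≢τ : a ≢ τ) →
      Move (attε p Q) u (att p' Q') → p ⟶[ a ] p' → Q' ≡ stepSet a Q →
      upd e u ≡ just e' → Win (att p' Q') e' → Strat (att p' Q') e' φ →
      Strat (attε p Q) e (⟨ a ⟩ φ ∣ a≢τ)
    s-immediateConj : ∀ {p Q e u e' ψs} → Move (att p Q) u (def p Q) →
      upd e u ≡ just e' → Win (def p Q) e' → Strat (def p Q) e' ψs →
      Strat (att p Q) e (⋀Φ (Σ Proc Q) ψs)
    s-lateConj : ∀ {p Q e u e' ψs} → Move (attε p Q) u (def p Q) →
      upd e u ≡ just e' → Win (def p Q) e' → Strat (def p Q) e' ψs →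
      Strat (attε p Q) e (⋀X (Σ Proc Q) ψs)
    s-conj : ∀ {p Q e} (ψs : Σ Proc Q → Ψ) →
      (∀ (qq : Σ Proc Q) → Σ Update λ u → Σ Energy λ eq →
         Move (def p Q) u (attConj p (proj₁ qq)) × upd e u ≡ just eq ×
         Win (attConj p (proj₁ qq)) eq × Strat (attConj p (proj₁ qq)) eq (ψs qq)) →
      Strat (def p Q) e ψs
    s-pos : ∀ {p q Q' e u e' χ} → Move (attConj p q) u (attε p Q') →
      upd e u ≡ just e' → Win (attε p Q') e' → Strat (attε p Q') e' χ →
      Strat (attConj p q) e (+⟨ε⟩ χ)
    s-neg : ∀ {p q P' e u e' χ} → Move (attConj p q) u (attε q P') →
      upd e u ≡ just e' → Win (attε q P') e' → Strat (attε q P') e' χ →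
      Strat (attConj p q) e (¬⟨ε⟩ χ)
    s-stable : ∀ {p Q Q' e u e' χ} → Move (attε p Q) u (defS p Q') →
      upd e u ≡ just e' → Win (defS p Q') e' → Strat (defS p Q') e' χ →
      Strat (attε p Q) e χ
    s-stableConj : ∀ {p Q e} (ψs : Σ Proc Q → Ψ) → ¬ Empty Q →
      (∀ (qq : Σ Proc Q) → Σ Update λ u → Σ Energy λ eq →
         Move (defS p Q) u (attConj p (proj₁ qq)) × upd e u ≡ just eq ×
         Win (attConj p (proj₁ qq)) eq × Strat (attConj p (proj₁ qq)) eq (ψs qq)) →
      Strat (defS p Q) e (⋀stable (Σ Proc Q) ψs)
    s-stableFinish : ∀ {p Q e u e'} → Move (defS p Q) u (def p Q) →
      upd e u ≡ just e' → Win (def p Q) e' →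
      Strat (defS p Q) e (⋀stable ⊥ ⊥-elim)
    s-branch : ∀ {p Q α p' Q' Qα e u e' χ} →
      Move (attε p Q) u (defη p α p' Q' Qα) →
      upd e u ≡ just e' → Win (defη p α p' Q' Qα) e' →
      Strat (defη p α p' Q' Qα) e' χ →
      Strat (attε p Q) e χ
    s-branchConj : ∀ {p α p' Q Qα e} (φα : Φ) (ψs : Σ Proc Q → Ψ) →
      (Σ Pred λ Q' → Σ Update λ u → Σ Update λ u' → Σ Energy λ e₁ → Σ Energy λ eα →
         Move (defη p α p' Q Qα) u (attη p' Q') × Move (attη p' Q') u' (att p' Q') ×
         upd e u ≡ just e₁ × upd e₁ u' ≡ just eα ×
         Win (att p' Q') eα × Strat (att p' Q') eα φα) →
      (∀ (qq : Σ Proc Q) → Σ Update λ u → Σ Energy λ eq →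
         Move (defη p α p' Q Qα) u (attConj p (proj₁ qq)) × upd e u ≡ just eq ×
         Win (attConj p (proj₁ qq)) eq × Strat (attConj p (proj₁ qq)) eq (ψs qq)) →
      Strat (defη p α p' Q Qα) e (⋀branch α φα (Σ Proc Q) ψs)

  Distinguishes : Φ → Proc → Pred → Set
  Distinguishes φ p Q = ⟦ φ ⟧ p × (∀ q → Q q → ¬ ⟦ φ ⟧ q)

-- Induction on the strategy derivation, with one invariant per kind of game
-- position. At [p,Q]^ε the
-- set Q is already τ-closed, so it suffices that χ holds somewhere below p
-- and holds nowhere in Q; the delay move then yields ⟨ε⟩χ. At [p,q]^∧ the
-- conjunct holds at p and fails at q, which for a negative conjunct is the
-- same invariant with p and q swapped. At defender positions the produced
-- χ holds at p itself and at no element of Q.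
module Submission where

open import Defs
open import Data.Product using (Σ; _×_; _,_; proj₁; proj₂)
open import Data.Maybe using (just)
open import Data.Empty using (⊥; ⊥-elim)
open import Relation.Nullary using (¬_)
open import Relation.Binary.PropositionalEquality using (_≡_; _≢_; refl)
open import Relation.Binary.Construct.Closure.ReflexiveTransitive using (ε; _◅_)

module Soundness (S : LTS) where
  open LTS S
  open Game S

  record DistinguishesNow (χ : X) (p : Proc) (Q : Pred) : Set where
    constructor distinguishesNow
    field
      holds    : ⟦ χ ⟧ε p
      excludes : ∀ q → Q q → ¬ ⟦ χ ⟧ε q

  DistinguishesAfterDelay : X → Proc → Pred → Set
  DistinguishesAfterDelay χ p Q = ⟦ χ ⟧εdiamond p × (∀ q → Q q → ¬ ⟦ χ ⟧ε q)

  Separates : Ψ → Proc → Proc → Set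
  Separates ψ p q = ⟦ ψ ⟧∧ p × ¬ ⟦ ψ ⟧∧ q

  ConjunctsSeparate : ∀ {Q} → Proc → (Σ Proc Q → Ψ) → Set
  ConjunctsSeparate p ψs = ∀ qq → Separates (ψs qq) p (proj₁ qq)

  distinguishes-irrefl : ∀ {φ p} → ¬ Distinguishes φ p ｛ p ｝
  distinguishes-irrefl (φp , ¬φp) = ¬φp _ refl φp

  now⇒afterDelay : ∀ {χ p Q} → DistinguishesNow χ p Q → DistinguishesAfterDelay χ p Q
  now⇒afterDelay {p = p} (distinguishesNow χp ¬χQ) = (p , ε , χp) , ¬χQ

  afterDelay-τ-prefix : ∀ {χ p p' Q} → p ⟶[ τ ] p' →
    DistinguishesAfterDelay χ p' Q → DistinguishesAfterDelay χ p Q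
  afterDelay-τ-prefix t ((p'' , p'↠p'' , χp'') , ¬χQ) = (p'' , t ◅ p'↠p'' , χp'') , ¬χQ

  ⟨ε⟩-distinguishes : ∀ {χ p Q} →
    DistinguishesAfterDelay χ p (↠set Q) → Distinguishes (⟨ε⟩ χ) p Q
  ⟨ε⟩-distinguishes (χp , ¬χQ↠) =
    χp , λ { q Qq (q' , q↠q' , χq') → ¬χQ↠ q' (q , Qq , q↠q') χq' }

  ⟨a⟩-distinguishes : ∀ {a φ p p' Q} (a≢τ : a ≢ τ) → p ⟶[ a ] p' →
    Distinguishes φ p' (stepSet a Q) → DistinguishesNow (⟨ a ⟩ φ ∣ a≢τ) p Q
  ⟨a⟩-distinguishes _ t (φp' , ¬φQ') = distinguishesNow
    (_ , t , φp') λ { q Qq (q' , t' , φq') → ¬φQ' q' (q , Qq , t') φq' }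

  +⟨ε⟩-separates : ∀ {χ p q} →
    DistinguishesAfterDelay χ p (↠set ｛ q ｝) → Separates (+⟨ε⟩ χ) p q
  +⟨ε⟩-separates d with ⟨ε⟩-distinguishes d
  ... | χp , ¬χq = χp , ¬χq _ refl

  ¬⟨ε⟩-separates : ∀ {χ p q} →
    DistinguishesAfterDelay χ q (↠set ｛ p ｝) → Separates (¬⟨ε⟩ χ) p q
  ¬⟨ε⟩-separates d with +⟨ε⟩-separates d
  ... | χq , ¬χp = ¬χp , λ ¬χq → ¬χq χq

  ⋀-distinguishes : ∀ {p Q} {ψs : Σ Proc Q → Ψ} →
    ConjunctsSeparate p ψs → Distinguishes (⋀Φ (Σ Proc Q) ψs) p Q
  ⋀-distinguishes sep =
    (λ qq → proj₁ (sep qq)) , λ q Qq ψsq → proj₂ (sep (q , Qq)) (ψsq (q , Qq))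

  ⋀X-distinguishes : ∀ {p Q} {ψs : Σ Proc Q → Ψ} →
    ConjunctsSeparate p ψs → DistinguishesNow (⋀X (Σ Proc Q) ψs) p Q
  ⋀X-distinguishes sep with ⋀-distinguishes sep
  ... | ψsp , ¬ψsQ = distinguishesNow ψsp ¬ψsQ

  -- The conjunct ¬⟨τ⟩T makes every q satisfying the conjunction stable, so
  -- the unstable part of Q, dropped by the defender, is excluded as well.
  ⋀stable-distinguishes : ∀ {p Q} {ψs : Σ Proc (stablePart Q) → Ψ} → Stable p →
    ConjunctsSeparate p ψs → DistinguishesNow (⋀stable (Σ Proc (stablePart Q)) ψs) p Q
  ⋀stable-distinguishes p-stable sep = distinguishesNow
    (p-stable , λ qq → proj₁ (sep qq))
    λ { q Qq (q-stable , ψsq) → proj₂ (sep (q , Qq , q-stable)) (ψsq (q , Qq , q-stable)) }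

  ⋀stable-distinguishes-unstable : ∀ {p Q} → Stable p → Empty (stablePart Q) →
    DistinguishesNow (⋀stable ⊥ ⊥-elim) p Q
  ⋀stable-distinguishes-unstable p-stable none-stable = distinguishesNow
    (p-stable , λ ())
    λ { q Qq (q-stable , _) → none-stable q (Qq , q-stable) }

  -- Q is split into Qα and Q ∖ Qα; constructively it suffices to refute
  -- Qα q, since then Q q already places q in Q ∖ Qα.
  ⋀branch-distinguishes : ∀ {p α p' φ Q Qα} {ψs : Σ Proc (Q ∖ Qα) → Ψ} →
    p ⟶⟨ α ⟩ p' → Distinguishes φ p' (stepSet⟨⟩ α Qα) → ConjunctsSeparate p ψs →
    DistinguishesNow (⋀branch α φ (Σ Proc (Q ∖ Qα)) ψs) p Q
  ⋀branch-distinguishes t (φp' , ¬φQα') sep = distinguishesNow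
    ((_ , t , φp') , λ qq → proj₁ (sep qq))
    λ { q Qq ((q' , t' , φq') , ψsq) →
          let ¬Qαq = λ Qαq → ¬φQα' q' (q , Qαq , t') φq'
          in proj₂ (sep (q , Qq , ¬Qαq)) (ψsq (q , Qq , ¬Qαq)) }

  StratAnswers : Pos → Proc → (Q : Pred) → Energy → (Σ Proc Q → Ψ) → Set₁
  StratAnswers g p Q e ψs = ∀ (qq : Σ Proc Q) → Σ Update λ u → Σ Energy λ e' →
    Move g u (attConj p (proj₁ qq)) × upd e u ≡ just e' ×
    Win (attConj p (proj₁ qq)) e' × Strat (attConj p (proj₁ qq)) e' (ψs qq)

  mutual
    sound-att : ∀ {p Q e φ} → Strat (att p Q) e φ → Distinguishes φ p Q
    sound-att (s-delay delay _ _ s)     = ⟨ε⟩-distinguishes (sound-attε s)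
    sound-att (s-immediateConj _ _ _ s) = ⋀-distinguishes (sound-def s)

    sound-attε : ∀ {p Q e χ} → Strat (attε p Q) e χ → DistinguishesAfterDelay χ p Q
    sound-attε (s-procr (procrastination t _) _ _ s) = afterDelay-τ-prefix t (sound-attε s)
    sound-attε (s-observation a≢τ _ t refl _ _ s) =
      now⇒afterDelay (⟨a⟩-distinguishes a≢τ t (sound-att s))
    sound-attε (s-lateConj _ _ _ s) = now⇒afterDelay (⋀X-distinguishes (sound-def s))
    sound-attε {Q = Q} (s-stable (stableConj p-stable) _ _ s) =
      now⇒afterDelay (sound-defS {Q = Q} s p-stable)
    sound-attε {Q = Q} (s-branch (branchingConj t _) _ _ s) =
      now⇒afterDelay (sound-defη {Q = Q} s t)

    sound-attConj : ∀ {p q e ψ} → Strat (attConj p q) e ψ → Separates ψ p q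
    sound-attConj (s-pos positiveConjunct _ _ s)       = +⟨ε⟩-separates (sound-attε s)
    sound-attConj (s-neg (negativeConjunct _) _ _ s)   = ¬⟨ε⟩-separates (sound-attε s)
    -- In the two mismatched cases the move's target forces p = q.
    sound-attConj (s-pos (negativeConjunct p≢p) _ _ _) = ⊥-elim (p≢p refl)
    sound-attConj (s-neg positiveConjunct _ _ s) =
      ⊥-elim (distinguishes-irrefl (⟨ε⟩-distinguishes (sound-attε s)))

    sound-answers : ∀ {g p Q e} {ψs : Σ Proc Q → Ψ} →
      StratAnswers g p Q e ψs → ConjunctsSeparate p ψs
    sound-answers answers qq with answers qq
    ... | _ , _ , _ , _ , _ , s = sound-attConj s

    sound-def : ∀ {p Q e ψs} → Strat (def p Q) e ψs → ConjunctsSeparate p ψs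
    sound-def (s-conj _ answers) = sound-answers answers

    sound-defS : ∀ {p Q e χ} → Strat (defS p (stablePart Q)) e χ → Stable p →
      DistinguishesNow χ p Q
    sound-defS (s-stableConj _ _ answers) p-stable =
      ⋀stable-distinguishes p-stable (sound-answers answers)
    sound-defS (s-stableFinish (stableFinishing none-stable) _ _) p-stable =
      ⋀stable-distinguishes-unstable p-stable none-stable

    sound-defη : ∀ {p α p' Q Qα e χ} → Strat (defη p α p' (Q ∖ Qα) Qα) e χ →
      p ⟶⟨ α ⟩ p' → DistinguishesNow χ p Q
    sound-defη (s-branchConj _ _ (_ , _ , _ , _ , _ , branchingObservation , _ , _ , _ , _ , s) answers) t =
      ⋀branch-distinguishes t (sound-att s) (sound-answers answers)

lemma30 : (S : LTS) → let open Game S in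
    ∀ {p : LTS.Proc S} {Q : Pred} {e : Energy} {φ : Φ} →
    Strat (att p Q) e φ → Distinguishes φ p Q
lemma30 S = Soundness.sound-att S
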